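{- Let $G$ and $H$ be graphs with $V(G)=\{u_1,\dots,u_m\}$ and $V(H)=\{v_1,\dots,v_n\}$, and let $M$ be a subset of $V(G\Box H)$. For any edges $w_{i,j}w_{i,j'}$ and $w_{i,j}w_{i',j}$ of $G\Box H$ we have (i) $P_{G\Box H}(M,w_{i,j}w_{i,j'})=P_{H_i}(M\cap V(H_i),w_{i,j}w_{i,j'})$; (ii) $P_{G\Box H}(M,w_{i,j}w_{i',j})=P_{G_j}(M\cap V(G_j),w_{i,j}w_{i',j})$.
   Context: Throughout, all graphs are finite, simple, undirected and connected. For a graph $X$, a set $M\subseteq V(X)$ and an edge $e\in E(X)$, $P_X(M,e)$ is the set of pairs $(x,y)$ with $x\in M$, $y\in V(X)$ such that $d_X(x,y)\neq d_{X-e}(x,y)$. The Cartesian product $G\Box H$ has vertex set $\{w_{i,j}: 1\le i\le m,1\le j\le n\}$ (with $w_{i,j}$ corresponding to $(u_i,v_j)$), where $w_{i,j}$ and $w_{i',j'}$ are adjacent iff either $i=i'$ and $v_jv_{j'}\in E(H)$, or $j=j'$ and $u_iu_{i'}\in E(G)$. For $v_j\in V(H)$, $G_j$ is the subgraph of $G\Box H$ induced by $\{w_{i,j}:1\le i\le m\}$; for $u_i\in V(G)$, $H_i$ is the subgraph induced by $\{w_{i,j}:1\le j\le n\}$. -}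

module Defs where

open import Data.Nat using (ℕ; zero; suc; _≤_)
open import Data.Fin using (Fin)
open import Data.Bool using (Bool; T)
open import Data.Product using (Σ; ∃; _×_; _,_; proj₁)
open import Data.Sum using (_⊎_)
open import Relation.Nullary using (¬_)
open import Relation.Binary.PropositionalEquality using (_≡_)
open import Function.Bundles using (_⇔_)

data Walk {V : Set} (R : V → V → Set) : V → V → ℕ → Set where
  here : ∀ {x} → Walk R x x 0
  step : ∀ {x z y k} → R x z → Walk R z y k → Walk R x y (suc k)

-- d_R(x,y) = k  (k is the length of a shortest walk). If no walk exists,
-- no k satisfies this, i.e. the distance is ∞.
IsDist : {V : Set} → (V → V → Set) → V → V → ℕ → Set
IsDist R x y k = Walk R x y k × (∀ k' → Walk R x y k' → k ≤ k')

SameDist : {V : Set} → (V → V → Set) → (V → V → Set) → V → V → Set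
SameDist R S x y = ∀ k → IsDist R x y k ⇔ IsDist S x y k

RemoveEdge : {V : Set} → (V → V → Set) → V → V → V → V → Set
RemoveEdge R a b x y = R x y × ¬ (x ≡ a × y ≡ b) × ¬ (x ≡ b × y ≡ a)

InP : {V : Set} → (V → V → Set) → (V → Set) → V → V → V → V → Set
InP R M a b x y = M x × ¬ SameDist R (RemoveEdge R a b) x y

record Graph (m : ℕ) : Set where
  field
    adj       : Fin m → Fin m → Bool
    adj-sym   : ∀ i j → T (adj i j) → T (adj j i)
    adj-irr   : ∀ i → ¬ T (adj i i)
    connected : ∀ i j → ∃ λ k → Walk (λ a b → T (adj a b)) i j k
open Graph public

-- Cartesian product G □ H, vertex (i , j) = w_{i,j}.
BoxAdj : ∀ {m n} → Graph m → Graph n → Fin m × Fin n → Fin m × Fin n → Set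
BoxAdj G H (i , j) (i' , j') = (i ≡ i' × T (adj H j j')) ⊎ (j ≡ j' × T (adj G i i'))

HV : ∀ {m n} → Fin m → Set
HV {m} {n} i = Σ (Fin m × Fin n) (λ w → proj₁ w ≡ i)

HAdj : ∀ {m n} (G : Graph m) (H : Graph n) (i : Fin m) → HV {m} {n} i → HV {m} {n} i → Set
HAdj G H i x y = BoxAdj G H (proj₁ x) (proj₁ y)

GV : ∀ {m n} → Fin n → Set
GV {m} {n} j = Σ (Fin m × Fin n) (λ w → Data.Product.proj₂ w ≡ j)

GAdj : ∀ {m n} (G : Graph m) (H : Graph n) (j : Fin n) → GV {m} {n} j → GV {m} {n} j → Set
GAdj G H j x y = BoxAdj G H (proj₁ x) (proj₁ y)

{-# OPTIONS --safe #-}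
-- Removing an edge e changes d(x, y) exactly when some walk from x to y is
-- strictly shorter than every walk avoiding e. In G □ H a walk projects onto
-- a walk of G plus a walk of H of no greater total length, and the projection
-- onto a layer containing e is non-expansive and collapses every step leaving
-- it. Hence if x or y lies off the layer of e, a shortest walk can be rerouted
-- through layers not containing e; if both lie on it, every e-avoiding walk
-- that leaves the layer is beaten by a shorter walk inside it, so the question
-- is decided inside the layer.
module Submission where

open import Defs
open import Data.Nat using (ℕ; suc; _+_; _≤_; _<_; s≤s; z≤n)
open import Data.Nat.Properties
  using (≤-trans; ≤-antisym; ≤-reflexive; <⇒≤; <-≤-trans; ≮⇒≥; +-comm; +-suc; m≤n+m)
open import Data.Nat.Induction using (<-rec; <-wellFounded)
open import Data.Fin using (Fin)
open import Data.Fin.Properties using (_≟_)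
open import Data.Bool using (T)
open import Data.Product using (Σ; ∃; _×_; _,_; proj₁; proj₂)
open import Data.Sum using (_⊎_; inj₁; inj₂)
open import Data.Empty using (⊥-elim)
open import Relation.Nullary using (¬_; yes; no)
open import Relation.Binary.Definitions using (DecidableEquality)
open import Relation.Binary.PropositionalEquality using (_≡_; refl; sym; trans; cong; subst)
open import Axiom.UniquenessOfIdentityProofs.WithK using (uip)
open import Induction.WellFounded using (Acc; acc)
open import Function using (id)
open import Function.Bundles using (_⇔_; mk⇔; Equivalence)

_++ʷ_ : ∀ {V : Set} {R : V → V → Set} {x y z k l} → Walk R x y k → Walk R y z l → Walk R x z (k + l)
here     ++ʷ w′ = w′
step r w ++ʷ w′ = step r (w ++ʷ w′)

walk-map : ∀ {V W : Set} {R : V → V → Set} {S : W → W → Set} (f : V → W) →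
  (∀ {x y} → R x y → S (f x) (f y)) → ∀ {x y k} → Walk R x y k → Walk S (f x) (f y) k
walk-map f g here       = here
walk-map f g (step r w) = step (g r) (walk-map f g w)

¬¬-least : ∀ {P : ℕ → Set} k → P k → ¬ ¬ ∃ λ d → P d × (∀ k′ → P k′ → d ≤ k′)
¬¬-least {P} k pk no-least = <-rec (λ k → ¬ P k) nothing-below k pk
  where
  nothing-below : ∀ k → (∀ {k′} → k′ < k → ¬ P k′) → ¬ P k
  nothing-below k below pk = no-least (k , pk , λ k′ pk′ → ≮⇒≥ (λ k′<k → below k′<k pk′))

Dominated : {V : Set} → (V → V → Set) → (V → V → Set) → V → V → Set
Dominated R S x y = ∀ {k} → Walk R x y k → ∃ λ k′ → k′ ≤ k × Walk S x y k′

module _ {V : Set} {R S : V → V → Set} (S⊆R : ∀ {u v} → S u v → R u v) {x y : V} where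

  dominated⇒sameDist : Dominated R S x y → SameDist R S x y
  dominated⇒sameDist dom k = mk⇔ to from
    where
    to : IsDist R x y k → IsDist S x y k
    to (w , least) with dom w
    ... | k′ , k′≤k , w′ =
      subst (Walk S x y) (≤-antisym k′≤k (least k′ (walk-map id S⊆R w′))) w′ ,
      λ k″ w″ → least k″ (walk-map id S⊆R w″)
    from : IsDist S x y k → IsDist R x y k
    from (w , least) = walk-map id S⊆R w , λ k″ w″ →
      let (k′ , k′≤k″ , w′) = dom w″ in ≤-trans (least k′ w′) k′≤k″

  sameDist⇒¬¬dominated : SameDist R S x y → ¬ ¬ Dominated R S x y
  sameDist⇒¬¬dominated same ¬dom = ¬dom (λ w → ⊥-elim (¬¬-least _ w shortest-dominates))
    where
    shortest-dominates : ¬ ∃ λ d → Walk R x y d × (∀ k′ → Walk R x y k′ → d ≤ k′)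
    shortest-dominates (d , isDist) = ¬dom λ w →
      d , proj₂ isDist _ w , proj₁ (Equivalence.to (same d) isDist)

¬sameDist-reflect : ∀ {V W : Set} {R S : V → V → Set} {R′ S′ : W → W → Set} {x y x′ y′} →
  (∀ {u v} → S u v → R u v) → (∀ {u v} → S′ u v → R′ u v) →
  (Dominated R′ S′ x′ y′ → Dominated R S x y) →
  ¬ SameDist R S x y → ¬ SameDist R′ S′ x′ y′
¬sameDist-reflect S⊆R S′⊆R′ transfer ¬same same′ =
  sameDist⇒¬¬dominated S′⊆R′ same′ (λ dom′ → ¬same (dominated⇒sameDist S⊆R (transfer dom′)))

module _ {V C : Set} {R : V → V → Set} (f : V → C) {a b x y : V} where

  removeEdge-off-fibre : R x y → ¬ f x ≡ f a → f a ≡ f b → RemoveEdge R a b x y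
  removeEdge-off-fibre r fx≢fa fa≡fb =
    r , (λ (x≡a , _) → fx≢fa (cong f x≡a)) ,
        (λ (x≡b , _) → fx≢fa (trans (cong f x≡b) (sym fa≡fb)))

  removeEdge-across-fibres : R x y → f a ≡ f b → ¬ f x ≡ f y → RemoveEdge R a b x y
  removeEdge-across-fibres r fa≡fb fx≢fy =
    r , (λ (x≡a , y≡b) → fx≢fy (trans (cong f x≡a) (trans fa≡fb (sym (cong f y≡b))))) ,
        (λ (x≡b , y≡a) → fx≢fy (trans (cong f x≡b) (trans (sym fa≡fb) (sym (cong f y≡a)))))

module Fibre {V C : Set} (X : V → V → Set) (f : V → C) (_≟ᶜ_ : DecidableEquality C) (c : C)
  (retract : V → Σ V (λ v → f v ≡ c))
  (retract-fixes : ∀ x (p : f x ≡ c) → retract x ≡ (x , p))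
  (retract-step : ∀ {x z} → X x z →
     X (proj₁ (retract x)) (proj₁ (retract z)) ⊎ retract x ≡ retract z)
  (retract-collapses : ∀ {x z} → f x ≡ c → X x z → ¬ f z ≡ c → retract z ≡ retract x)
  where

  F : Set
  F = Σ V (λ v → f v ≡ c)

  X[F] : F → F → Set
  X[F] u v = X (proj₁ u) (proj₁ v)

  proj₁-injective : {u v : F} → proj₁ u ≡ proj₁ v → u ≡ v
  proj₁-injective {x , p} {.x , q} refl = cong (x ,_) (uip p q)

  retract-walk : ∀ {x y k} → Walk X x y k → ∃ λ k′ → k′ ≤ k × Walk X[F] (retract x) (retract y) k′
  retract-walk here = 0 , z≤n , here
  retract-walk {y = y} (step r w) with retract-walk w | retract-step r
  ... | k′ , k′≤k , w′ | inj₁ r′   = suc k′ , s≤s k′≤k , step r′ w′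
  ... | k′ , k′≤k , w′ | inj₂ same =
    k′ , ≤-trans k′≤k (m≤n+m _ 1) , subst (λ s → Walk X[F] s (retract y) k′) (sym same) w′

  retract-walk-to : ∀ {x y k} {u v : F} → retract x ≡ u → retract y ≡ v →
    Walk X x y k → ∃ λ k′ → k′ ≤ k × Walk X[F] u v k′
  retract-walk-to refl refl = retract-walk

  module Edge (a b : F) where

    Xₑ : V → V → Set
    Xₑ = RemoveEdge X (proj₁ a) (proj₁ b)

    X[F]ₑ : F → F → Set
    X[F]ₑ = RemoveEdge X[F] a b

    lower : ∀ {u v k} → Walk X[F]ₑ u v k → Walk Xₑ (proj₁ u) (proj₁ v) k
    lower = walk-map proj₁ λ (r , ≢ab , ≢ba) →
      r , (λ (u≡a , v≡b) → ≢ab (proj₁-injective u≡a , proj₁-injective v≡b)) ,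
          (λ (u≡b , v≡a) → ≢ba (proj₁-injective u≡b , proj₁-injective v≡a))

    raise-step : ∀ {x z} {px : f x ≡ c} {pz : f z ≡ c} → Xₑ x z → X[F]ₑ (x , px) (z , pz)
    raise-step (r , ≢ab , ≢ba) =
      r , (λ (x≡a , z≡b) → ≢ab (cong proj₁ x≡a , cong proj₁ z≡b)) ,
          (λ (x≡b , z≡a) → ≢ba (cong proj₁ x≡b , cong proj₁ z≡a))

    -- Once an e-avoiding walk leaves the fibre, retracting the rest of it saves the leaving step.
    stays-or-shortcut : ∀ {x y k} (px : f x ≡ c) (py : f y ≡ c) → Walk Xₑ x y k →
      Walk X[F]ₑ (x , px) (y , py) k ⊎ ∃ λ k′ → k′ < k × Walk X[F] (x , px) (y , py) k′
    stays-or-shortcut {x} px py here = inj₁ (subst (λ p → Walk X[F]ₑ (x , px) (x , p) 0) (uip px py) here)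
    stays-or-shortcut {x} px py (step {z = z} r w) with f z ≟ᶜ c
    ... | yes pz with stays-or-shortcut pz py w
    ...   | inj₁ w′              = inj₁ (step (raise-step r) w′)
    ...   | inj₂ (k′ , k′<k , w′) = inj₂ (suc k′ , s≤s k′<k , step (proj₁ r) w′)
    stays-or-shortcut {x} px py (step {z = z} r w) | no ¬pz
      with retract-walk-to (trans (retract-collapses px (proj₁ r) ¬pz) (retract-fixes x px))
                           (retract-fixes _ py) (walk-map id proj₁ w)
    ... | k′ , k′≤k , w′ = inj₂ (k′ , s≤s k′≤k , w′)

    dominated-fibre⇒ : ∀ {u v} → Dominated X Xₑ (proj₁ u) (proj₁ v) → Dominated X[F] X[F]ₑ u v
    dominated-fibre⇒ {u} {v} dom w = go (<-wellFounded _) w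
      where
      go : ∀ {k} → Acc _<_ k → Walk X[F] u v k → ∃ λ k′ → k′ ≤ k × Walk X[F]ₑ u v k′
      go (acc shorter) w with dom (walk-map proj₁ id w)
      ... | k′ , k′≤k , w′ with stays-or-shortcut (proj₂ u) (proj₂ v) w′
      ...   | inj₁ w″ = k′ , k′≤k , w″
      ...   | inj₂ (k″ , k″<k′ , w″) with go (shorter (<-≤-trans k″<k′ k′≤k)) w″
      ...     | k‴ , k‴≤k″ , w‴ = k‴ , ≤-trans k‴≤k″ (≤-trans (<⇒≤ k″<k′) k′≤k) , w‴

    dominated-fibre⇐ : ∀ {u v} → Dominated X[F] X[F]ₑ u v → Dominated X Xₑ (proj₁ u) (proj₁ v)
    dominated-fibre⇐ {u} {v} dom w
      with retract-walk-to (retract-fixes _ (proj₂ u)) (retract-fixes _ (proj₂ v)) w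
    ... | k′ , k′≤k , w′ with dom w′
    ...   | k″ , k″≤k′ , w″ = k″ , ≤-trans k″≤k′ k′≤k , lower w″

    inP-fibre : (∀ {x y} → ¬ f x ≡ c ⊎ ¬ f y ≡ c → Dominated X Xₑ x y) →
      ∀ (M : V → Set) x y →
      InP X M (proj₁ a) (proj₁ b) x y
      ⇔ Σ F (λ x′ → Σ F (λ y′ → proj₁ x′ ≡ x × proj₁ y′ ≡ y ×
          InP X[F] (λ z → M (proj₁ z)) a b x′ y′))
    inP-fibre off-fibre M x y = mk⇔ to from
      where
      to : InP X M (proj₁ a) (proj₁ b) x y → _
      to (Mx , ¬same) with f x ≟ᶜ c | f y ≟ᶜ c
      ... | yes px | yes py = (x , px) , (y , py) , refl , refl , Mx ,
                              ¬sameDist-reflect proj₁ proj₁ dominated-fibre⇐ ¬same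
      ... | no ¬px | _      = ⊥-elim (¬same (dominated⇒sameDist proj₁ (off-fibre (inj₁ ¬px))))
      ... | yes _  | no ¬py = ⊥-elim (¬same (dominated⇒sameDist proj₁ (off-fibre (inj₂ ¬py))))
      from : _ → InP X M (proj₁ a) (proj₁ b) x y
      from (x′ , y′ , refl , refl , Mx , ¬same) =
        Mx , ¬sameDist-reflect proj₁ proj₁ dominated-fibre⇒ ¬same

Adj : ∀ {m} → Graph m → Fin m → Fin m → Set
Adj G a b = T (adj G a b)

adj⇒≢ : ∀ {m} (G : Graph m) {a b} → Adj G a b → ¬ a ≡ b
adj⇒≢ G g refl = adj-irr G _ g

module Product {m n} (G : Graph m) (H : Graph n) where

  X : Fin m × Fin n → Fin m × Fin n → Set
  X = BoxAdj G H

  project : ∀ {x y k} → Walk X x y k →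
    ∃ λ p → ∃ λ q → Walk (Adj G) (proj₁ x) (proj₁ y) p × Walk (Adj H) (proj₂ x) (proj₂ y) q × p + q ≤ k
  project here = 0 , 0 , here , here , z≤n
  project (step (inj₁ (refl , h)) w) with project w
  ... | p , q , wG , wH , le = p , suc q , wG , step h wH , ≤-trans (≤-reflexive (+-suc p q)) (s≤s le)
  project (step (inj₂ (refl , g)) w) with project w
  ... | p , q , wG , wH , le = suc p , q , step g wG , wH , s≤s le

  row-retract : (i : Fin m) → Fin m × Fin n → HV {m} {n} i
  row-retract i (_ , b) = (i , b) , refl

  row-retract-fixes : ∀ i x (p : proj₁ x ≡ i) → row-retract i x ≡ (x , p)
  row-retract-fixes i _ refl = refl

  row-retract-step : ∀ {i x z} → X x z →
    X (proj₁ (row-retract i x)) (proj₁ (row-retract i z)) ⊎ row-retract i x ≡ row-retract i z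
  row-retract-step (inj₁ (refl , h)) = inj₁ (inj₁ (refl , h))
  row-retract-step (inj₂ (refl , _)) = inj₂ refl

  row-retract-collapses : ∀ {i x z} → proj₁ x ≡ i → X x z → ¬ proj₁ z ≡ i →
    row-retract i z ≡ row-retract i x
  row-retract-collapses refl (inj₁ (refl , _)) z∉row = ⊥-elim (z∉row refl)
  row-retract-collapses refl (inj₂ (refl , _)) _     = refl

  module Row (i : Fin m) = Fibre X proj₁ _≟_ i
    (row-retract i) (row-retract-fixes i) row-retract-step row-retract-collapses

  column-retract : (j : Fin n) → Fin m × Fin n → GV {m} {n} j
  column-retract j (a , _) = (a , j) , refl

  column-retract-fixes : ∀ j x (p : proj₂ x ≡ j) → column-retract j x ≡ (x , p)
  column-retract-fixes j _ refl = refl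

  column-retract-step : ∀ {j x z} → X x z →
    X (proj₁ (column-retract j x)) (proj₁ (column-retract j z)) ⊎ column-retract j x ≡ column-retract j z
  column-retract-step (inj₁ (refl , _)) = inj₂ refl
  column-retract-step (inj₂ (refl , g)) = inj₁ (inj₂ (refl , g))

  column-retract-collapses : ∀ {j x z} → proj₂ x ≡ j → X x z → ¬ proj₂ z ≡ j →
    column-retract j z ≡ column-retract j x
  column-retract-collapses refl (inj₂ (refl , _)) z∉column = ⊥-elim (z∉column refl)
  column-retract-collapses refl (inj₁ (refl , _)) _        = refl

  module Column (j : Fin n) = Fibre X proj₂ _≟_ j
    (column-retract j) (column-retract-fixes j) column-retract-step column-retract-collapses

  row-edge-off-row : ∀ {i j j′ a b c d} → ¬ a ≡ i ⊎ ¬ c ≡ i →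
    Dominated X (RemoveEdge X (i , j) (i , j′)) (a , b) (c , d)
  row-edge-off-row {a = a} {b} {c} {d} off {k} w with project w | off
  ... | p , q , wG , wH , le | inj₁ a≢i =
    q + p , subst (_≤ k) (+-comm p q) le ,
    walk-map (a ,_) (λ h → removeEdge-off-fibre {R = X} proj₁ (inj₁ (refl , h)) a≢i refl) wH ++ʷ
    walk-map (_, d) (λ g → removeEdge-across-fibres {R = X} proj₁ (inj₂ (refl , g)) refl (adj⇒≢ G g)) wG
  ... | p , q , wG , wH , le | inj₂ c≢i =
    p + q , le ,
    walk-map (_, b) (λ g → removeEdge-across-fibres {R = X} proj₁ (inj₂ (refl , g)) refl (adj⇒≢ G g)) wG ++ʷ
    walk-map (c ,_) (λ h → removeEdge-off-fibre {R = X} proj₁ (inj₁ (refl , h)) c≢i refl) wH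

  column-edge-off-column : ∀ {i i′ j a b c d} → ¬ b ≡ j ⊎ ¬ d ≡ j →
    Dominated X (RemoveEdge X (i , j) (i′ , j)) (a , b) (c , d)
  column-edge-off-column {a = a} {b} {c} {d} off {k} w with project w | off
  ... | p , q , wG , wH , le | inj₁ b≢j =
    p + q , le ,
    walk-map (_, b) (λ g → removeEdge-off-fibre {R = X} proj₂ (inj₂ (refl , g)) b≢j refl) wG ++ʷ
    walk-map (c ,_) (λ h → removeEdge-across-fibres {R = X} proj₂ (inj₁ (refl , h)) refl (adj⇒≢ H h)) wH
  ... | p , q , wG , wH , le | inj₂ d≢j =
    q + p , subst (_≤ k) (+-comm p q) le ,
    walk-map (a ,_) (λ h → removeEdge-across-fibres {R = X} proj₂ (inj₁ (refl , h)) refl (adj⇒≢ H h)) wH ++ʷ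
    walk-map (_, d) (λ g → removeEdge-off-fibre {R = X} proj₂ (inj₂ (refl , g)) d≢j refl) wG

mainTheorem4 : ∀ {m n} (G : Graph m) (H : Graph n) (M : Fin m × Fin n → Set) →
    (∀ i j j' → T (adj H j j') → ∀ x y →
      InP (BoxAdj G H) M (i , j) (i , j') x y
      ⇔ Σ (HV {m} {n} i) (λ x' → Σ (HV {m} {n} i) (λ y' →
          proj₁ x' ≡ x × proj₁ y' ≡ y ×
          InP (HAdj G H i) (λ z → M (proj₁ z)) ((i , j) , refl) ((i , j') , refl) x' y')))
    × (∀ i i' j → T (adj G i i') → ∀ x y →
      InP (BoxAdj G H) M (i , j) (i' , j) x y
      ⇔ Σ (GV {m} {n} j) (λ x' → Σ (GV {m} {n} j) (λ y' →
          proj₁ x' ≡ x × proj₁ y' ≡ y ×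
          InP (GAdj G H j) (λ z → M (proj₁ z)) ((i , j) , refl) ((i' , j) , refl) x' y')))
mainTheorem4 G H M =
  (λ i j j′ _ → Row.Edge.inP-fibre i ((i , j) , refl) ((i , j′) , refl) row-edge-off-row M) ,
  (λ i i′ j _ → Column.Edge.inP-fibre j ((i , j) , refl) ((i′ , j) , refl) column-edge-off-column M)
  where open Product G H
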